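{- Let $\mathcal{G}$ be a grounded graph class. Then every level-$\mathcal{G}$ weighted graph has a sorted $\mathcal{G}$-safe edge elimination scheme if and only if $\mathcal{G}$ is sandwich monotone.
   Context: All graphs are finite, simple and undirected. For a graph class $\mathcal{G}$ and $G\in\mathcal{G}$, a set $F\subseteq E(G)$ is $\mathcal{G}$-safe if $G-F\in\mathcal{G}$; an edge $e$ is $\mathcal{G}$-safe if $G-e\in\mathcal{G}$. $\mathcal{G}$ is grounded if for every $G\in\mathcal{G}$ the graph $G-E(G)$ is in $\mathcal{G}$. $\mathcal{G}$ is sandwich monotone if for every $G\in\mathcal{G}$ and every non-empty $\mathcal{G}$-safe set $F\subseteq E(G)$ there is a $\mathcal{G}$-safe edge in $F$. A weighted ($k$-weighted) graph is a pair $(G,\omega)$ with $\omega:E(G)\to\{1,\dots,k\}$ surjective for some positive integer $k$. For $1\le i\le k+1$, the $i$-th level graph of $(G,\omega)$ is obtained from $G$ by deleting all edges $e$ with $\omega(e)<i$; $(G,\omega)$ is level-$\mathcal{G}$ if all its level graphs are in $\mathcal{G}$. For an edge ordering $\tau=(e_1,\dots,e_m)$ of $G$ let $G^i_\tau=G-\{e_1,\dots,e_i\}$; $\tau$ is a $\mathcal{G}$-safe edge elimination scheme if $G\in\mathcal{G}$ and $G^i_\tau\in\mathcal{G}$ for all $i\in\{1,\dots,m\}$; it is sorted if $\omega(e_i)\le\omega(e_j)$ whenever $i<j$. -}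

module Defs where

open import Data.Nat using (ℕ; _≤_; _<_; _+_; _≤?_)
open import Data.Bool using (Bool; true; false; _∧_; _∨_; not)
open import Data.Fin using (Fin; toℕ; _≟_)
open import Data.Vec using (Vec; lookup; tabulate)
open import Data.List using (List; []; _∷_; take; length)
open import Data.List.Membership.Propositional using (_∈_)
open import Data.List.Relation.Unary.All using (All)
open import Data.List.Relation.Unary.AllPairs using (AllPairs)
open import Data.List.Relation.Unary.Unique.Propositional using (Unique)
open import Data.Product using (Σ; _×_; _,_; ∃; ∃-syntax)
open import Relation.Binary.PropositionalEquality using (_≡_)
open import Relation.Nullary.Decidable using (⌊_⌋)

-- A (finite, simple, undirected) graph on vertex set Fin n is given by its
-- adjacency matrix; simplicity = symmetric and irreflexive.
Adj : ℕ → Set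
Adj n = Vec (Vec Bool n) n

adj : ∀ {n} → Adj n → Fin n → Fin n → Bool
adj G i j = lookup (lookup G i) j

IsSimple : ∀ {n} → Adj n → Set
IsSimple G = (∀ i j → adj G i j ≡ adj G j i) × (∀ i → adj G i i ≡ false)

-- A graph class is a predicate on graphs (only ever applied to simple graphs).
GraphClass : Set₁
GraphClass = (n : ℕ) → Adj n → Set

_∖_ : ∀ {n} → Adj n → Adj n → Adj n
G ∖ F = tabulate λ i → tabulate λ j → adj G i j ∧ not (adj F i j)

single : ∀ {n} → Fin n → Fin n → Adj n
single u v = tabulate λ i → tabulate λ j →
  (⌊ i ≟ u ⌋ ∧ ⌊ j ≟ v ⌋) ∨ (⌊ i ≟ v ⌋ ∧ ⌊ j ≟ u ⌋)

IsEdgeSubset : ∀ {n} → Adj n → Adj n → Set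
IsEdgeSubset {n} F G =
  (∀ i j → adj F i j ≡ adj F j i) × (∀ i j → adj F i j ≡ true → adj G i j ≡ true)

Grounded : GraphClass → Set
Grounded 𝒢 = ∀ n (G : Adj n) → IsSimple G → 𝒢 n G → 𝒢 n (G ∖ G)

SandwichMonotone : GraphClass → Set
SandwichMonotone 𝒢 = ∀ n (G : Adj n) → IsSimple G → 𝒢 n G →
  ∀ (F : Adj n) → IsEdgeSubset F G →
  (∃[ i ] ∃[ j ] adj F i j ≡ true) →
  𝒢 n (G ∖ F) →
  ∃[ i ] ∃[ j ] (adj F i j ≡ true × 𝒢 n (G ∖ single i j))

-- Weights: ω i j is the weight of edge {i,j} (values on non-edges irrelevant).
-- ω : E(G) → {1,…,k} surjective, k ≥ 1.
IsWeighting : ∀ {n} → Adj n → ℕ → (Fin n → Fin n → ℕ) → Set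
IsWeighting G k ω =
  1 ≤ k ×
  (∀ i j → adj G i j ≡ true → ω i j ≡ ω j i) ×
  (∀ i j → adj G i j ≡ true → 1 ≤ ω i j × ω i j ≤ k) ×
  (∀ l → 1 ≤ l → l ≤ k → ∃[ i ] ∃[ j ] (adj G i j ≡ true × ω i j ≡ l))

level : ∀ {n} → Adj n → (Fin n → Fin n → ℕ) → ℕ → Adj n
level G ω l = tabulate λ i → tabulate λ j → adj G i j ∧ ⌊ l ≤? ω i j ⌋

LevelClass : GraphClass → ∀ {n} → Adj n → ℕ → (Fin n → Fin n → ℕ) → Set
LevelClass 𝒢 {n} G k ω = ∀ l → 1 ≤ l → l ≤ k + 1 → 𝒢 n (level G ω l)

-- Edges are written (u , v) with u < v.
Edge : ℕ → Set
Edge n = Fin n × Fin n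

IsEdgeOrdering : ∀ {n} → Adj n → List (Edge n) → Set
IsEdgeOrdering {n} G τ =
  All (λ { (u , v) → toℕ u < toℕ v × adj G u v ≡ true }) τ ×
  Unique τ ×
  (∀ (u v : Fin n) → toℕ u < toℕ v → adj G u v ≡ true → (u , v) ∈ τ)

deleteAll : ∀ {n} → Adj n → List (Edge n) → Adj n
deleteAll G [] = G
deleteAll G ((u , v) ∷ es) = deleteAll (G ∖ single u v) es

IsSafeScheme : GraphClass → ∀ {n} → Adj n → List (Edge n) → Set
IsSafeScheme 𝒢 {n} G τ =
  𝒢 n G × (∀ i → 1 ≤ i → i ≤ length τ → 𝒢 n (deleteAll G (take i τ)))

IsSorted : ∀ {n} → (Fin n → Fin n → ℕ) → List (Edge n) → Set
IsSorted ω τ = AllPairs (λ { (a , b) (c , d) → ω a b ≤ ω c d }) τ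

{-# OPTIONS --safe #-}
-- Given a nonempty safe set F, weight the edges of F by 1 and all other edges by 2. The level
-- graphs are G, G ∖ F and the edgeless graph G ∖ G, which lie in 𝒢 (the last because 𝒢 is
-- grounded), so a sorted safe scheme exists; its first edge has the least weight 1, so it lies
-- in F, and it is safe.
--
-- Conversely, let m be the least weight of a level-𝒢 graph G. Removing all edges of weight m
-- leaves the level graph m + 1, so they form a safe set and sandwich monotonicity yields a safe
-- edge e of weight m. Each level graph of G ∖ e is either G ∖ e itself (levels ≤ m) or a level
-- graph of G, so G ∖ e is again level-𝒢; prefixing e to a scheme for G ∖ e, obtained by induction
-- on the number of edges, gives a sorted safe scheme for G.
module Submission where

open import Defs
open import Data.Bool using (Bool; true; false; _∧_; _∨_; not)
open import Data.Bool.Properties using (∧-comm; ∨-comm; ∧-identityʳ; ∧-zeroʳ; ∧-conicalˡ; not-involutive)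
  renaming (_≟_ to _≟ᵇ_)
open import Data.Empty using (⊥-elim)
open import Data.Fin using (Fin; toℕ; _≟_)
import Data.Fin as Fin
open import Data.Fin.Properties using (any?; toℕ-injective)
open import Data.Fin.Subset using (Subset; ∣_∣; _⊆_; _⊂_)
open import Data.Fin.Subset.Properties using (p⊆q⇒∣p∣≤∣q∣; p⊂q⇒∣p∣<∣q∣)
open import Data.List using ([]; _∷_)
open import Data.List.Membership.Propositional using (_∈_)
open import Data.List.Relation.Unary.All as All using ([]; _∷_)
open import Data.List.Relation.Unary.AllPairs using ([]; _∷_)
open import Data.List.Relation.Unary.Any using (here; there)
open import Data.Nat using (ℕ; zero; suc; _≤_; _<_; _+_; z≤n; s≤s; s≤s⁻¹; z<s; _≤?_; _<?_)
open import Data.Nat.Induction using (<-wellFounded)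
open import Data.Nat.Properties
  using (≤-refl; ≤-reflexive; ≤-trans; <-trans; ≤-<-trans; ≰⇒>; ≮⇒≥; <⇒≱; 1+n≰n; <-asym; <-cmp;
         +-mono-≤; +-mono-<-≤; +-mono-≤-<; m<m+n; m≤m+n; m≤n+m)
open import Data.Product using (∃; ∃₂; ∃-syntax; _×_; _,_; proj₁; proj₂)
open import Data.Sum using (_⊎_; inj₁; inj₂)
open import Data.Vec using (Vec; []; _∷_; lookup; tabulate; map; sum)
open import Data.Vec.Properties using (lookup∘tabulate; tabulate∘lookup; tabulate-cong; []=⇒lookup; lookup⇒[]=)
open import Function using (_∘_)
open import Function.Bundles using (_⇔_; mk⇔)
open import Induction.WellFounded using (Acc; acc)
open import Relation.Binary.Definitions using (tri<; tri≈; tri>)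
open import Relation.Binary.PropositionalEquality
open import Relation.Nullary using (Dec; yes; no; does; ¬_; _×-dec_; _⊎-dec_)
open import Relation.Nullary.Decidable using (⌊_⌋; isYes≗does; dec-true; dec-false)

private variable
  n : ℕ
  X : Set
  G F H : Adj n
  ω : Fin n → Fin n → ℕ
  u v : Fin n
  l : ℕ

does-true⇒ : (x? : Dec X) → does x? ≡ true → X
does-true⇒ (yes x) _ = x

⌊⌋-true : (x? : Dec X) → X → ⌊ x? ⌋ ≡ true
⌊⌋-true x? x = trans (isYes≗does x?) (dec-true x? x)

⌊⌋-false : (x? : Dec X) → ¬ X → ⌊ x? ⌋ ≡ false
⌊⌋-false x? ¬x = trans (isYes≗does x?) (dec-false x? ¬x)

guarded-∧-cong : ∀ a {b c} → (a ≡ true → b ≡ c) → a ∧ b ≡ a ∧ c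
guarded-∧-cong true  b≡c = b≡c refl
guarded-∧-cong false _   = refl

true≢false : ¬ (true ≡ false)
true≢false ()

lookup-ext : ∀ {m} {xs ys : Vec X m} → (∀ i → lookup xs i ≡ lookup ys i) → xs ≡ ys
lookup-ext {xs = xs} {ys} xs≗ys =
  trans (sym (tabulate∘lookup xs)) (trans (tabulate-cong xs≗ys) (tabulate∘lookup ys))

Adj-ext : (∀ i j → adj G i j ≡ adj H i j) → G ≡ H
Adj-ext G≗H = lookup-ext λ i → lookup-ext (G≗H i)

adj-tabulate : (f : Fin n → Fin n → Bool) (i j : Fin n) →
               adj (tabulate λ i → tabulate λ j → f i j) i j ≡ f i j
adj-tabulate f i j =
  trans (cong (λ row → lookup row j) (lookup∘tabulate _ i)) (lookup∘tabulate (f i) j)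

adj-∖ : (G F : Adj n) (i j : Fin n) → adj (G ∖ F) i j ≡ adj G i j ∧ not (adj F i j)
adj-∖ G F = adj-tabulate _

adj-level : (G : Adj n) (ω : Fin n → Fin n → ℕ) (l : ℕ) (i j : Fin n) →
            adj (level G ω l) i j ≡ adj G i j ∧ ⌊ l ≤? ω i j ⌋
adj-level G ω l = adj-tabulate _

sameEdge? : (u v i j : Fin n) → Dec ((i ≡ u × j ≡ v) ⊎ (i ≡ v × j ≡ u))
sameEdge? u v i j = i ≟ u ×-dec j ≟ v ⊎-dec i ≟ v ×-dec j ≟ u

adj-single : (u v i j : Fin n) → adj (single u v) i j ≡ does (sameEdge? u v i j)
adj-single u v i j = trans (adj-tabulate _ i j)
  (cong₂ _∨_ (cong₂ _∧_ (isYes≗does (i ≟ u)) (isYes≗does (j ≟ v)))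
             (cong₂ _∧_ (isYes≗does (i ≟ v)) (isYes≗does (j ≟ u))))

Symmetric : Adj n → Set
Symmetric A = ∀ i j → adj A i j ≡ adj A j i

infix 4 _⊆ᴱ_

_⊆ᴱ_ : Adj n → Adj n → Set
A ⊆ᴱ B = ∀ i j → adj A i j ≡ true → adj B i j ≡ true

HasEdge : Adj n → Set
HasEdge A = ∃₂ λ i j → adj A i j ≡ true

hasEdge? : (A : Adj n) → Dec (HasEdge A)
hasEdge? A = any? λ i → any? λ j → adj A i j ≟ᵇ true

∖-⊆ : (G F : Adj n) → G ∖ F ⊆ᴱ G
∖-⊆ G F i j e = ∧-conicalˡ _ _ (trans (sym (adj-∖ G F i j)) e)

level-⊆ : (G : Adj n) (ω : Fin n → Fin n → ℕ) (l : ℕ) → level G ω l ⊆ᴱ G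
level-⊆ G ω l i j e = ∧-conicalˡ _ _ (trans (sym (adj-level G ω l i j)) e)

∖-isSimple : IsSimple G → Symmetric F → IsSimple (G ∖ F)
∖-isSimple {G = G} {F = F} (G-sym , G-irr) F-sym =
  (λ i j → trans (adj-∖ G F i j)
                 (trans (cong₂ (λ g f → g ∧ not f) (G-sym i j) (F-sym i j)) (sym (adj-∖ G F j i)))) ,
  (λ i → trans (adj-∖ G F i i) (cong (_∧ not (adj F i i)) (G-irr i)))

∖-disjoint : (∀ i j → adj F i j ≡ true → adj G i j ≡ false) → G ∖ F ≡ G
∖-disjoint {F = F} {G = G} disjoint =
  Adj-ext λ i j → trans (adj-∖ G F i j) (keep (adj G i j) (adj F i j) (disjoint i j))
  where
  keep : ∀ g f → (f ≡ true → g ≡ false) → g ∧ not f ≡ g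
  keep g false _      = ∧-identityʳ g
  keep g true  g≡false = trans (∧-zeroʳ g) (sym (g≡false refl))

∖-∖ : F ⊆ᴱ G → G ∖ (G ∖ F) ≡ F
∖-∖ {F = F} {G = G} F⊆G = Adj-ext λ i j →
  trans (adj-∖ G (G ∖ F) i j)
        (trans (cong (λ x → adj G i j ∧ not x) (adj-∖ G F i j))
               (restore (adj G i j) (adj F i j) (F⊆G i j)))
  where
  restore : ∀ g f → (f ≡ true → g ≡ true) → g ∧ not (g ∧ not f) ≡ f
  restore true  f     _   = not-involutive f
  restore false false _   = refl
  restore false true  f⇒g = f⇒g refl

single-uv : (u v : Fin n) → adj (single u v) u v ≡ true
single-uv u v = trans (adj-single u v u v) (dec-true (sameEdge? u v u v) (inj₁ (refl , refl)))

single-true⇒ : (u v i j : Fin n) → adj (single u v) i j ≡ true → (i ≡ u × j ≡ v) ⊎ (i ≡ v × j ≡ u)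
single-true⇒ u v i j e = does-true⇒ (sameEdge? u v i j) (trans (sym (adj-single u v i j)) e)

single-false : (u v i j : Fin n) → ¬ (i ≡ u × j ≡ v) → ¬ (i ≡ v × j ≡ u) → adj (single u v) i j ≡ false
single-false u v i j ¬uv ¬vu = trans (adj-single u v i j)
  (dec-false (sameEdge? u v i j) λ { (inj₁ p) → ¬uv p ; (inj₂ p) → ¬vu p })

single-symmetric : (u v : Fin n) → Symmetric (single u v)
single-symmetric u v i j = begin
  adj (single u v) i j
    ≡⟨ adj-single u v i j ⟩
  does (i ≟ u) ∧ does (j ≟ v) ∨ does (i ≟ v) ∧ does (j ≟ u)
    ≡⟨ ∨-comm (does (i ≟ u) ∧ does (j ≟ v)) _ ⟩
  does (i ≟ v) ∧ does (j ≟ u) ∨ does (i ≟ u) ∧ does (j ≟ v)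
    ≡⟨ cong₂ _∨_ (∧-comm (does (i ≟ v)) _) (∧-comm (does (i ≟ u)) _) ⟩
  does (j ≟ u) ∧ does (i ≟ v) ∨ does (j ≟ v) ∧ does (i ≟ u)
    ≡⟨ sym (adj-single u v j i) ⟩
  adj (single u v) j i ∎
  where open ≡-Reasoning

single-comm : (u v : Fin n) → single u v ≡ single v u
single-comm u v = Adj-ext λ i j →
  trans (adj-single u v i j)
        (trans (∨-comm (does (i ≟ u) ∧ does (j ≟ v)) _) (sym (adj-single v u i j)))

∖-single-removes : (G : Adj n) (u v : Fin n) → adj (G ∖ single u v) u v ≡ false
∖-single-removes G u v =
  trans (adj-∖ G (single u v) u v)
        (trans (cong (λ s → adj G u v ∧ not s) (single-uv u v)) (∧-zeroʳ (adj G u v)))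

∖-single-keeps : ∀ {i j} → adj G i j ≡ true → ¬ (i ≡ u × j ≡ v) → ¬ (i ≡ v × j ≡ u) →
                 adj (G ∖ single u v) i j ≡ true
∖-single-keeps {G = G} {u = u} {v = v} {i} {j} Gij ¬uv ¬vu =
  trans (adj-∖ G (single u v) i j)
        (cong₂ (λ g s → g ∧ not s) Gij (single-false u v i j ¬uv ¬vu))

orient : (P : Fin n → Fin n → Set) → (∀ {i j} → P i j → P j i) → (∀ {i} → ¬ P i i) →
         ∃₂ P → ∃₂ λ u v → toℕ u < toℕ v × P u v
orient P P-sym P-irr (i , j , p) with <-cmp (toℕ i) (toℕ j)
... | tri< i<j _ _ = i , j , i<j , p
... | tri≈ _ i≡j _ = ⊥-elim (P-irr (subst (P i) (sym (toℕ-injective i≡j)) p))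
... | tri> _ _ j<i = j , i , j<i , P-sym p

edgeCount : ∀ {m} → Vec (Subset n) m → ℕ
edgeCount = sum ∘ map ∣_∣

edgeCount-mono-≤ : ∀ {m} {xs ys : Vec (Subset n) m} →
                   (∀ i → lookup xs i ⊆ lookup ys i) → edgeCount xs ≤ edgeCount ys
edgeCount-mono-≤ {xs = []}     {[]}     _     = z≤n
edgeCount-mono-≤ {xs = x ∷ xs} {y ∷ ys} xs⊆ys =
  +-mono-≤ (p⊆q⇒∣p∣≤∣q∣ (xs⊆ys Fin.zero)) (edgeCount-mono-≤ {xs = xs} {ys} (xs⊆ys ∘ Fin.suc))

edgeCount-mono-< : ∀ {m} {xs ys : Vec (Subset n) m} →
                   (∀ i → lookup xs i ⊆ lookup ys i) →
                   ∀ k → lookup xs k ⊂ lookup ys k → edgeCount xs < edgeCount ys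
edgeCount-mono-< {xs = x ∷ xs} {y ∷ ys} xs⊆ys Fin.zero x⊂y =
  +-mono-<-≤ (p⊂q⇒∣p∣<∣q∣ x⊂y) (edgeCount-mono-≤ {xs = xs} {ys} (xs⊆ys ∘ Fin.suc))
edgeCount-mono-< {xs = x ∷ xs} {y ∷ ys} xs⊆ys (Fin.suc k) xk⊂yk =
  +-mono-≤-< (p⊆q⇒∣p∣≤∣q∣ (xs⊆ys Fin.zero)) (edgeCount-mono-< {xs = xs} {ys} (xs⊆ys ∘ Fin.suc) k xk⊂yk)

edgeCount-< : F ⊆ᴱ G → adj F u v ≡ false → adj G u v ≡ true → edgeCount F < edgeCount G
edgeCount-< {F = F} {G = G} {u = u} {v = v} F⊆G Fuv Guv =
  edgeCount-mono-< {xs = F} {G} rows⊆ u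
    (rows⊆ u , v , lookup⇒[]= v _ Guv , λ v∈ → true≢false (trans (sym ([]=⇒lookup v∈)) Fuv))
  where
  rows⊆ : ∀ i → lookup F i ⊆ lookup G i
  rows⊆ i {j} j∈ = lookup⇒[]= j _ (F⊆G i j ([]=⇒lookup j∈))

edgeCount-∖-single : (G : Adj n) → adj G u v ≡ true → edgeCount (G ∖ single u v) < edgeCount G
edgeCount-∖-single {u = u} {v = v} G Guv =
  edgeCount-< {F = G ∖ single u v} {G = G} (∖-⊆ G (single u v)) (∖-single-removes G u v) Guv

level-excludes : ∀ {i j} → ¬ l ≤ ω i j → adj (level G ω l) i j ≡ false
level-excludes {l = l} {ω = ω} {G = G} {i} {j} l≰ω =
  trans (adj-level G ω l i j) (trans (cong (adj G i j ∧_) (⌊⌋-false (l ≤? ω i j) l≰ω)) (∧-zeroʳ _))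

level-below : (∀ i j → adj G i j ≡ true → l ≤ ω i j) → level G ω l ≡ G
level-below {G = G} {l = l} {ω = ω} light = Adj-ext λ i j →
  trans (adj-level G ω l i j)
        (trans (guarded-∧-cong (adj G i j) (⌊⌋-true (l ≤? ω i j) ∘ light i j)) (∧-identityʳ _))

level-above : (∀ i j → adj G i j ≡ true → ω i j < l) → level G ω l ≡ G ∖ G
level-above {G = G} {ω = ω} {l = l} heavy = Adj-ext λ i j →
  trans (adj-level G ω l i j)
        (trans (guarded-∧-cong (adj G i j)
                  (λ Gij → trans (⌊⌋-false (l ≤? ω i j) (<⇒≱ (heavy i j Gij))) (cong not (sym Gij))))
               (sym (adj-∖ G G i j)))

level-∖ : (G F : Adj n) → level (G ∖ F) ω l ≡ level G ω l ∖ F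
level-∖ {ω = ω} {l = l} G F = Adj-ext λ i j → begin
  adj (level (G ∖ F) ω l) i j                         ≡⟨ adj-level (G ∖ F) ω l i j ⟩
  adj (G ∖ F) i j ∧ ⌊ l ≤? ω i j ⌋                    ≡⟨ cong (_∧ ⌊ l ≤? ω i j ⌋) (adj-∖ G F i j) ⟩
  (adj G i j ∧ not (adj F i j)) ∧ ⌊ l ≤? ω i j ⌋      ≡⟨ swap (adj G i j) (not (adj F i j)) _ ⟩
  (adj G i j ∧ ⌊ l ≤? ω i j ⌋) ∧ not (adj F i j)      ≡⟨ cong (_∧ not (adj F i j)) (sym (adj-level G ω l i j)) ⟩
  adj (level G ω l) i j ∧ not (adj F i j)             ≡⟨ sym (adj-∖ (level G ω l) F i j) ⟩
  adj (level G ω l ∖ F) i j                           ∎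
  where
  open ≡-Reasoning
  swap : ∀ a b c → (a ∧ b) ∧ c ≡ (a ∧ c) ∧ b
  swap true  b c = ∧-comm b c
  swap false b c = refl

level-symmetric : Symmetric G → (∀ i j → adj G i j ≡ true → ω i j ≡ ω j i) → Symmetric (level G ω l)
level-symmetric {G = G} {ω = ω} {l = l} G-sym ω-sym i j = begin
  adj (level G ω l) i j                 ≡⟨ adj-level G ω l i j ⟩
  adj G i j ∧ ⌊ l ≤? ω i j ⌋            ≡⟨ guarded-∧-cong (adj G i j) (cong (λ w → ⌊ l ≤? w ⌋) ∘ ω-sym i j) ⟩
  adj G i j ∧ ⌊ l ≤? ω j i ⌋            ≡⟨ cong (_∧ ⌊ l ≤? ω j i ⌋) (G-sym i j) ⟩
  adj G j i ∧ ⌊ l ≤? ω j i ⌋            ≡⟨ sym (adj-level G ω l j i) ⟩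
  adj (level G ω l) j i                 ∎
  where open ≡-Reasoning

∖-level-light : ∀ {i j} → adj (G ∖ level G ω l) i j ≡ true → ω i j < l
∖-level-light {G = G} {ω = ω} {l = l} {i} {j} e = ≰⇒> λ l≤ω → true≢false (begin
  true                                        ≡⟨ sym e ⟩
  adj (G ∖ level G ω l) i j                   ≡⟨ adj-∖ G (level G ω l) i j ⟩
  adj G i j ∧ not (adj (level G ω l) i j)     ≡⟨ cong (λ x → adj G i j ∧ not x) (level-includes l≤ω) ⟩
  adj G i j ∧ false                           ≡⟨ ∧-zeroʳ (adj G i j) ⟩
  false                                       ∎)
  where
  open ≡-Reasoning
  level-includes : l ≤ ω i j → adj (level G ω l) i j ≡ true
  level-includes l≤ω =
    trans (adj-level G ω l i j) (cong₂ _∧_ (∖-⊆ G (level G ω l) i j e) (⌊⌋-true (l ≤? ω i j) l≤ω))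

IsLightest : (Fin n → Fin n → ℕ) → Adj n → Fin n → Fin n → Set
IsLightest ω G u v = ∀ i j → adj G i j ≡ true → ω u v ≤ ω i j

lightest-edge : (G : Adj n) (ω : Fin n → Fin n → ℕ) → HasEdge G →
                ∃₂ λ a b → adj G a b ≡ true × IsLightest ω G a b
lightest-edge G ω (a , b , e) = descend a b (<-wellFounded (ω a b)) e
  where
  descend : ∀ a b → Acc _<_ (ω a b) → adj G a b ≡ true →
            ∃₂ λ a b → adj G a b ≡ true × IsLightest ω G a b
  descend a b (acc lighter) e with any? (λ c → any? λ d → (adj G c d ≟ᵇ true) ×-dec (ω c d <? ω a b))
  ... | yes (c , d , e′ , c-d<a-b) = descend c d (lighter c-d<a-b) e′
  ... | no  none                   = a , b , e , λ c d e′ → ≮⇒≥ λ c-d<a-b → none (c , d , e′ , c-d<a-b)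

HasSortedSafeScheme : GraphClass → Adj n → (Fin n → Fin n → ℕ) → Set
HasSortedSafeScheme 𝒢 G ω = ∃[ τ ] (IsEdgeOrdering G τ × IsSorted ω τ × IsSafeScheme 𝒢 G τ)

emptyScheme : {𝒢 : GraphClass} → ¬ HasEdge G → 𝒢 n G → HasSortedSafeScheme 𝒢 G ω
emptyScheme none G∈𝒢 =
  [] , ([] , [] , λ u v _ Guv → ⊥-elim (none (u , v , Guv))) , [] , G∈𝒢 , λ { _ (s≤s _) () }

edgeOrdering-∷ : ∀ {τ} → toℕ u < toℕ v → adj G u v ≡ true →
                 IsEdgeOrdering (G ∖ single u v) τ → IsEdgeOrdering G ((u , v) ∷ τ)
edgeOrdering-∷ {u = u} {v = v} {G = G} {τ} u<v Guv (edges , unique , complete) =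
  (u<v , Guv) ∷ All.map (λ { {c , d} (c<d , e) → c<d , ∖-⊆ G (single u v) c d e }) edges ,
  All.map (λ { {c , d} (_ , e) refl → true≢false (trans (sym e) (∖-single-removes G u v)) }) edges ∷ unique ,
  complete′
  where
  complete′ : ∀ c d → toℕ c < toℕ d → adj G c d ≡ true → (c , d) ∈ (u , v) ∷ τ
  complete′ c d c<d Gcd with c ≟ u ×-dec d ≟ v
  ... | yes (refl , refl) = here refl
  ... | no  ≢uv = there (complete c d c<d (∖-single-keeps {G = G} Gcd ≢uv λ { (refl , refl) → <-asym c<d u<v }))

safeScheme-∷ : {𝒢 : GraphClass} → ∀ {τ} → 𝒢 n G → IsSafeScheme 𝒢 (G ∖ single u v) τ →
               IsSafeScheme 𝒢 G ((u , v) ∷ τ)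
safeScheme-∷ G∈𝒢 (G′∈𝒢 , safe) = G∈𝒢 , λ where
  (suc zero)    _ _          → G′∈𝒢
  (suc (suc i)) _ (s≤s i≤τ) → safe (suc i) (s≤s z≤n) i≤τ

sortedSafeScheme-∷ : {𝒢 : GraphClass} → toℕ u < toℕ v → adj G u v ≡ true → IsLightest ω G u v → 𝒢 n G →
                     HasSortedSafeScheme 𝒢 (G ∖ single u v) ω → HasSortedSafeScheme 𝒢 G ω
sortedSafeScheme-∷ {u = u} {v = v} {G = G} {𝒢 = 𝒢} u<v Guv lightest G∈𝒢
                   (τ , ordering@(edges , _) , sorted , scheme) =
  _ ∷ τ ,
  edgeOrdering-∷ {G = G} u<v Guv ordering ,
  All.map (λ { {c , d} (_ , e) → lightest c d (∖-⊆ G (single u v) c d e) }) edges ∷ sorted ,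
  safeScheme-∷ {G = G} {u = u} {v = v} {𝒢 = 𝒢} {τ = τ} G∈𝒢 scheme

sortedScheme-head : {𝒢 : GraphClass} → ∀ {a b} τ → (a , b) ∈ τ → IsSorted ω τ → IsSafeScheme 𝒢 G τ →
                    ∃₂ λ u v → ω u v ≤ ω a b × 𝒢 n (G ∖ single u v)
sortedScheme-head {ω = ω} ((u , v) ∷ τ) ab∈ (head≤ ∷ _) (_ , safe) =
  u , v , head≤ab ab∈ , safe 1 (s≤s z≤n) (s≤s z≤n)
  where
  head≤ab : ∀ {a b} → (a , b) ∈ (u , v) ∷ τ → ω u v ≤ ω a b
  head≤ab (here refl)  = ≤-refl
  head≤ab (there ab∈τ) = All.lookup head≤ ab∈τ

-- From sandwich monotonicity to sorted schemes

record AllLevelsIn (𝒢 : GraphClass) (G : Adj n) (ω : Fin n → Fin n → ℕ) : Set where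
  field
    simple            : IsSimple G
    weights-symmetric : ∀ i j → adj G i j ≡ true → ω i j ≡ ω j i
    levels            : ∀ l → 𝒢 n (level G ω l)

  graph∈𝒢 : 𝒢 n G
  graph∈𝒢 = subst (𝒢 n) (level-below {G = G} {l = 0} {ω = ω} λ _ _ _ → z≤n) (levels 0)

module _ {𝒢 : GraphClass} (sandwich : SandwichMonotone 𝒢) {n} (ω : Fin n → Fin n → ℕ) where

  -- The edges of weight at most ω a b form a safe set, since removing them leaves a level graph.
  light-safe-edge : ∀ {H a b} → AllLevelsIn 𝒢 H ω → adj H a b ≡ true →
                    ∃₂ λ i j → ω i j ≤ ω a b × adj H i j ≡ true × 𝒢 n (H ∖ single i j)
  light-safe-edge {H} {a} {b} closed Hab
    with sandwich n H simple graph∈𝒢 (H ∖ upper) (light-symmetric , ∖-⊆ H upper) (a , b , light-ab) H∖light∈𝒢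
    where
    open AllLevelsIn closed
    upper = level H ω (suc (ω a b))
    light-symmetric : Symmetric (H ∖ upper)
    light-symmetric =
      proj₁ (∖-isSimple {G = H} {F = upper} simple
               (level-symmetric {G = H} {ω = ω} {l = suc (ω a b)} (proj₁ simple) weights-symmetric))
    light-ab : adj (H ∖ upper) a b ≡ true
    light-ab = trans (adj-∖ H upper a b)
                     (cong₂ (λ h x → h ∧ not x) Hab (level-excludes {l = suc (ω a b)} {ω = ω} {G = H} 1+n≰n))
    H∖light∈𝒢 : 𝒢 n (H ∖ (H ∖ upper))
    H∖light∈𝒢 = subst (𝒢 n) (sym (∖-∖ {F = upper} {G = H} (level-⊆ H ω (suc (ω a b))))) (levels (suc (ω a b)))
  ... | i , j , light-ij , safe =
    i , j , s≤s⁻¹ (∖-level-light {G = H} {ω = ω} light-ij) ,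
    ∖-⊆ H (level H ω (suc (ω a b))) i j light-ij , safe

  SafeLightestEdge : Adj n → Fin n → Fin n → Set
  SafeLightestEdge H u v = adj H u v ≡ true × IsLightest ω H u v × 𝒢 n (H ∖ single u v)

  safe-lightest-edge : ∀ {H} → AllLevelsIn 𝒢 H ω → HasEdge H →
                       ∃₂ λ u v → toℕ u < toℕ v × SafeLightestEdge H u v
  safe-lightest-edge {H} closed nonempty =
    let a , b , Hab , ab-lightest = lightest-edge H ω nonempty
        i , j , ij≤ab , Hij , safe = light-safe-edge closed Hab
    in  orient (SafeLightestEdge H) swap irreflexive
               (i , j , Hij , (λ c d Hcd → ≤-trans ij≤ab (ab-lightest c d Hcd)) , safe)
    where
    open AllLevelsIn closed
    swap : ∀ {i j} → SafeLightestEdge H i j → SafeLightestEdge H j i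
    swap {i} {j} (Hij , lightest , safe) =
      trans (sym (proj₁ simple i j)) Hij ,
      subst (λ w → ∀ c d → adj H c d ≡ true → w ≤ ω c d) (weights-symmetric i j Hij) lightest ,
      subst (λ s → 𝒢 n (H ∖ s)) (single-comm i j) safe
    irreflexive : ∀ {i} → ¬ SafeLightestEdge H i i
    irreflexive {i} (Hii , _) = true≢false (trans (sym Hii) (proj₂ simple i))

  allLevelsIn-∖-lightest : ∀ {H u v} → AllLevelsIn 𝒢 H ω → SafeLightestEdge H u v →
                           AllLevelsIn 𝒢 (H ∖ single u v) ω
  allLevelsIn-∖-lightest {H} {u} {v} closed (Huv , lightest , safe) = record
    { simple            = ∖-isSimple {G = H} {F = single u v} simple (single-symmetric u v)
    ; weights-symmetric = λ i j → weights-symmetric i j ∘ ∖-⊆ H (single u v) i j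
    ; levels            = levels′
    }
    where
    open AllLevelsIn closed
    levels′ : ∀ l → 𝒢 n (level (H ∖ single u v) ω l)
    levels′ l with l ≤? ω u v
    ... | yes l≤uv = subst (𝒢 n) (sym (level-below {G = H ∖ single u v} λ i j e →
                       ≤-trans l≤uv (lightest i j (∖-⊆ H (single u v) i j e)))) safe
    ... | no  l≰uv = subst (𝒢 n) (sym (trans (level-∖ H (single u v)) (∖-disjoint {F = single u v} excluded)))
                       (levels l)
      where
      excluded : ∀ i j → adj (single u v) i j ≡ true → adj (level H ω l) i j ≡ false
      excluded i j uv≡ij with single-true⇒ u v i j uv≡ij
      ... | inj₁ (refl , refl) = level-excludes {G = H} l≰uv
      ... | inj₂ (refl , refl) = level-excludes {G = H} (l≰uv ∘ subst (l ≤_) (sym (weights-symmetric u v Huv)))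

  sortedSafeScheme : ∀ H → Acc _<_ (edgeCount H) → AllLevelsIn 𝒢 H ω → HasSortedSafeScheme 𝒢 H ω
  sortedSafeScheme H (acc smaller) closed with hasEdge? H
  ... | no  none     = emptyScheme {G = H} {ω = ω} {𝒢 = 𝒢} none (AllLevelsIn.graph∈𝒢 closed)
  ... | yes nonempty = eliminate (safe-lightest-edge closed nonempty)
    where
    eliminate : (∃₂ λ u v → toℕ u < toℕ v × SafeLightestEdge H u v) → HasSortedSafeScheme 𝒢 H ω
    eliminate (u , v , u<v , edge@(Huv , lightest , _)) =
      sortedSafeScheme-∷ {G = H} {𝒢 = 𝒢} u<v Huv lightest (AllLevelsIn.graph∈𝒢 closed)
        (sortedSafeScheme (H ∖ single u v) (smaller (edgeCount-∖-single H Huv))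
                          (allLevelsIn-∖-lightest closed edge))

LevelSortable : GraphClass → Set
LevelSortable 𝒢 = ∀ n (G : Adj n) (k : ℕ) (ω : Fin n → Fin n → ℕ) →
  IsSimple G → IsWeighting G k ω → LevelClass 𝒢 G k ω → HasSortedSafeScheme 𝒢 G ω

-- Levels 0 and 1 coincide, as do all levels beyond k + 1.
levelClass⇒allLevels : {𝒢 : GraphClass} → ∀ {k} → IsWeighting G k ω → LevelClass 𝒢 G k ω →
                       ∀ l → 𝒢 n (level G ω l)
levelClass⇒allLevels {n} {G} {ω} {𝒢} {k} (_ , _ , bounds , _) levels zero =
  subst (𝒢 n) (trans (level-below {G = G} (λ i j → proj₁ ∘ bounds i j))
                     (sym (level-below {G = G} {l = 0} {ω = ω} λ _ _ _ → z≤n)))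
        (levels 1 ≤-refl (m≤n+m 1 k))
levelClass⇒allLevels {n} {G} {ω} {𝒢} {k} (_ , _ , bounds , _) levels (suc l) with suc l ≤? k + 1
... | yes l≤k+1 = levels (suc l) (s≤s z≤n) l≤k+1
... | no  l≰k+1 =
  subst (𝒢 n) (trans (level-above {G = G} below-k+1)
                     (sym (level-above {G = G} λ i j Gij → <-trans (below-k+1 i j Gij) (≰⇒> l≰k+1))))
        (levels (k + 1) (m≤n+m 1 k) ≤-refl)
  where
  below-k+1 : ∀ i j → adj G i j ≡ true → ω i j < k + 1
  below-k+1 i j Gij = ≤-<-trans (proj₂ (bounds i j Gij)) (m<m+n k z<s)

sandwichMonotone⇒levelSortable : {𝒢 : GraphClass} → SandwichMonotone 𝒢 → LevelSortable 𝒢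
sandwichMonotone⇒levelSortable {𝒢 = 𝒢} sandwich n G k ω simple weighting@(_ , weights-symmetric , _) levels =
  sortedSafeScheme sandwich ω G (<-wellFounded _) record
    { simple            = simple
    ; weights-symmetric = weights-symmetric
    ; levels            = levelClass⇒allLevels {G = G} {ω = ω} {𝒢 = 𝒢} weighting levels
    }

-- From sorted schemes to sandwich monotonicity

mark : Bool → ℕ
mark true  = 1
mark false = 2

-- The level graphs of this weighting are G, G ∖ F and G ∖ G.
marking : Adj n → Fin n → Fin n → ℕ
marking F i j = mark (adj F i j)

mark-bounds : ∀ b → 1 ≤ mark b × mark b ≤ 2
mark-bounds true  = s≤s z≤n , s≤s z≤n
mark-bounds false = s≤s z≤n , ≤-refl

mark-≤1 : ∀ {b} → mark b ≤ 1 → b ≡ true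
mark-≤1 {true}  _            = refl
mark-≤1 {false} (s≤s ())

level-marking-2 : (G F : Adj n) → level G (marking F) 2 ≡ G ∖ F
level-marking-2 G F = Adj-ext λ i j →
  trans (adj-level G (marking F) 2 i j)
        (trans (cong (adj G i j ∧_) (two≤mark (adj F i j))) (sym (adj-∖ G F i j)))
  where
  two≤mark : ∀ b → ⌊ 2 ≤? mark b ⌋ ≡ not b
  two≤mark true  = refl
  two≤mark false = refl

marking-levels : {𝒢 : GraphClass} → Grounded 𝒢 → IsSimple G → 𝒢 n G → 𝒢 n (G ∖ F) →
                 ∀ l → 1 ≤ l → 𝒢 n (level G (marking F) l)
marking-levels {n} {G} {F} {𝒢} _ _ G∈𝒢 _ 1 _ =
  subst (𝒢 n) (sym (level-below {G = G} λ i j _ → proj₁ (mark-bounds (adj F i j)))) G∈𝒢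
marking-levels {n} {G} {F} {𝒢} _ _ _ G∖F∈𝒢 2 _ =
  subst (𝒢 n) (sym (level-marking-2 G F)) G∖F∈𝒢
marking-levels {n} {G} {F} {𝒢} grounded simple G∈𝒢 _ (suc (suc (suc l))) _ =
  subst (𝒢 n) (sym (level-above {G = G} λ i j _ → s≤s (≤-trans (proj₂ (mark-bounds (adj F i j))) (m≤m+n 2 l))))
        (grounded n G simple G∈𝒢)

-- Surjectivity of a weighting forces k = 1 when F contains every edge of G.
marking-weighting : Symmetric F → F ⊆ᴱ G → HasEdge F → ∃[ k ] IsWeighting G k (marking F)
marking-weighting {F = F} {G = G} F-sym F⊆G (a , b , Fab) with hasEdge? (G ∖ F)
... | yes (c , d , G∖Fcd) =
  2 , s≤s z≤n , (λ i j _ → cong mark (F-sym i j)) , (λ i j _ → mark-bounds (adj F i j)) , λ where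
    1 _ _ → a , b , F⊆G a b Fab , cong mark Fab
    2 _ _ → c , d , ∖-⊆ G F c d G∖Fcd , cong mark (not-true (trans (sym (adj-∖ G F c d)) G∖Fcd))
    (suc (suc (suc _))) _ (s≤s (s≤s ()))
  where
  not-true : ∀ {g f} → g ∧ not f ≡ true → f ≡ false
  not-true {true} {false} _ = refl
... | no none =
  1 , ≤-refl , (λ i j _ → cong mark (F-sym i j)) ,
  (λ i j Gij → proj₁ (mark-bounds (adj F i j)) , ≤-reflexive (cong mark (in-F i j Gij))) , λ where
    1 _ _ → a , b , F⊆G a b Fab , cong mark Fab
    (suc (suc _)) _ (s≤s ())
  where
  in-F : ∀ i j → adj G i j ≡ true → adj F i j ≡ true
  in-F i j Gij with adj F i j in Fij
  ... | true  = refl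
  ... | false = ⊥-elim (none (i , j , trans (adj-∖ G F i j) (cong₂ (λ g f → g ∧ not f) Gij Fij)))

levelSortable⇒sandwichMonotone : {𝒢 : GraphClass} → Grounded 𝒢 → LevelSortable 𝒢 → SandwichMonotone 𝒢
levelSortable⇒sandwichMonotone {𝒢} grounded sortable n G simple G∈𝒢 F (F-sym , F⊆G) F≠∅ G∖F∈𝒢 =
  let a , b , a<b , Fab = orient (λ i j → adj F i j ≡ true) (λ {i} {j} → trans (F-sym j i)) F-irreflexive F≠∅
      k , weighting     = marking-weighting {F = F} {G = G} F-sym F⊆G F≠∅
      levels            = λ l 1≤l _ → marking-levels {F = F} grounded simple G∈𝒢 G∖F∈𝒢 l 1≤l
      τ , (_ , _ , complete) , sorted , scheme = sortable n G k (marking F) simple weighting levels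
      u , v , uv≤ab , safe = sortedScheme-head {ω = marking F} {G = G} {𝒢 = 𝒢} τ
                               (complete a b a<b (F⊆G a b Fab)) sorted scheme
  in  u , v , mark-≤1 (≤-trans uv≤ab (≤-reflexive (cong mark Fab))) , safe
  where
  F-irreflexive : ∀ {i} → ¬ adj F i i ≡ true
  F-irreflexive {i} Fii = true≢false (trans (sym (F⊆G i i Fii)) (proj₂ simple i))

proposition3p1 : (𝒢 : GraphClass) → Grounded 𝒢 →
    ((∀ n (G : Adj n) (k : ℕ) (ω : Fin n → Fin n → ℕ) →
        IsSimple G → IsWeighting G k ω → LevelClass 𝒢 G k ω →
        ∃[ τ ] (IsEdgeOrdering G τ × IsSorted ω τ × IsSafeScheme 𝒢 G τ))
     ⇔ SandwichMonotone 𝒢)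
proposition3p1 𝒢 grounded =
  mk⇔ (levelSortable⇒sandwichMonotone grounded) sandwichMonotone⇒levelSortable
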